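{- Let $n,m\ge1$ with $n\ge3m+3$, and let $u\in\mathbf{G}(\widehat{\mathbb{Z}})$ be the element with trivial components away from $p$ and $p$-component $\begin{pmatrix}I_3&T\\0&I_3\end{pmatrix}$, $T=\begin{pmatrix}1&1&0\\1&0&1\\0&1&1\end{pmatrix}$. Then, as subgroups of $\mathbf{H}(\mathbb{A}_f)$, \[uK'_{n,m(p)}u^{ -1}\cap\mathbf{H}=uK'_{n,m+1}u^{ -1}\cap\mathbf{H}.\]
   Context: $\mathbf{G}=\mathbf{GSp}_6$ over $\mathbb{Z}$ is defined by $A^tJA=\nu(A)J$ with $J=\begin{pmatrix}0&I_3'\\-I_3'&0\end{pmatrix}$, $I_3'$ the $3\times3$ antidiagonal matrix of ones. $\mathbf{H}=\mathbf{GL}_2\times_{\det}\mathbf{GL}_2\times_{\det}\mathbf{GL}_2\subseteq\mathbf{G}$, the $i$-th factor $\begin{pmatrix}a_i&b_i\\c_i&d_i\end{pmatrix}$ occupying the entries in rows/columns $\{1,6\},\{2,5\},\{3,4\}$ for $i=1,2,3$, zero elsewhere. Fix a prime $p$ and a compact open $K^{(p)}\subseteq\mathbf{G}(\widehat{\mathbb{Z}}^{(p)})$; $K_n=K^{(p)}K_n^p$ with $K_n^p=\{g\in\mathbf{G}(\mathbb{Z}_p):\text{sixth row of }g\equiv(0,\dots,0,1)\bmod p^n\}$. $K_{\mathbf{G}}(N)=\ker(\mathbf{G}(\widehat{\mathbb{Z}})\to\mathbf{G}(\mathbb{Z}/N))$, $\eta_p=\mathrm{diag}(p^3,p^2,p^2,p,p,1)\in\mathbf{G}(\mathbb{Q}_p)$.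 For $m\ge0$: $K'_{n,m}=K_n\cap\eta_p^mK_n\eta_p^{ -m}\cap K_{\mathbf{G}}(p^m)$ and $K'_{n,m(p)}=K_n\cap\eta_p^{m+1}K_n\eta_p^{ -(m+1)}\cap K_{\mathbf{G}}(p^m)$. -}

module Defs where

open import Data.Nat as ℕ using (ℕ; zero; suc)
open import Data.Integer as ℤ using (ℤ; +_; _+_; _*_; _-_; -_)
open import Data.Integer.Divisibility.Signed using (_∣_; ∣m∣n⇒∣m+n; ∣n⇒∣m*n; ∣m⇒∣m*n; ∣m∣n⇒∣m-n)
import Data.Integer.Divisibility.Signed as Div
open import Data.Integer.Solver using (module +-*-Solver)
open import Data.Fin using (Fin; toℕ; #_)
open import Data.Product using (Σ; ∃; _×_; _,_)
open import Relation.Binary.PropositionalEquality using (_≡_; refl; subst; sym)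
open import Relation.Nullary using (¬_)

-- The p-adic integers ℤ_p, modelled as the inverse limit lim ℤ/p^k:
-- a sequence of integers x_k (x_k represents x mod p^k) with
-- x_{k+1} ≡ x_k (mod p^k).

record ℤₚ (p : ℕ) : Set where
  constructor mkℤₚ
  field
    seq : ℕ → ℤ
    coh : ∀ k → (+ (p ℕ.^ k)) ∣ (seq (suc k) - seq k)
open ℤₚ public

module _ {p : ℕ} where

  _≡_[modp^_] : ℤₚ p → ℤₚ p → ℕ → Set
  x ≡ y [modp^ n ] = (+ (p ℕ.^ n)) ∣ (seq x n - seq y n)

  _≈ₚ_ : ℤₚ p → ℤₚ p → Set
  x ≈ₚ y = ∀ k → x ≡ y [modp^ k ]

  ι : ℤ → ℤₚ p
  ι c = mkℤₚ (λ _ → c) (λ k → subst (λ z → (+ (p ℕ.^ k)) ∣ z) (sym (i≡j⇒i-j≡0 {c} refl)) (Div.divides (+ 0) refl))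
    where open import Data.Integer.Properties using (i≡j⇒i-j≡0)

  _+ₚ_ : ℤₚ p → ℤₚ p → ℤₚ p
  x +ₚ y = mkℤₚ (λ k → seq x k + seq y k)
    (λ k → subst (λ z → (+ (p ℕ.^ k)) ∣ z)
      (eq (seq x (suc k)) (seq x k) (seq y (suc k)) (seq y k))
      (∣m∣n⇒∣m+n (coh x k) (coh y k)))
    where
    open +-*-Solver
    eq : ∀ a b c d → (a - b) + (c - d) ≡ (a + c) - (b + d)
    eq = solve 4 (λ a b c d → (a :- b) :+ (c :- d) := (a :+ c) :- (b :+ d)) refl

  -ₚ_ : ℤₚ p → ℤₚ p
  -ₚ x = mkℤₚ (λ k → - seq x k)
    (λ k → subst (λ z → (+ (p ℕ.^ k)) ∣ z)
      (eq (seq x (suc k)) (seq x k))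
      (Div.∣m⇒∣-m (coh x k)))
    where
    open +-*-Solver
    eq : ∀ a b → - (a - b) ≡ (- a) - (- b)
    eq = solve 2 (λ a b → :- (a :- b) := (:- a) :- (:- b)) refl

  _*ₚ_ : ℤₚ p → ℤₚ p → ℤₚ p
  x *ₚ y = mkℤₚ (λ k → seq x k * seq y k)
    (λ k → subst (λ z → (+ (p ℕ.^ k)) ∣ z)
      (eq (seq x (suc k)) (seq x k) (seq y (suc k)) (seq y k))
      (∣m∣n⇒∣m+n (∣n⇒∣m*n (seq x (suc k)) (coh y k)) (∣m⇒∣m*n (seq y k) (coh x k))))
    where
    open +-*-Solver
    eq : ∀ a b c d → a * (c - d) + (a - b) * d ≡ a * c - b * d
    eq = solve 4 (λ a b c d → a :* (c :- d) :+ (a :- b) :* d := a :* c :- b :* d) refl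

  0ₚ 1ₚ : ℤₚ p
  0ₚ = ι (+ 0)
  1ₚ = ι (+ 1)

  IsUnit : ℤₚ p → Set
  IsUnit x = ∃ λ y → (x *ₚ y) ≈ₚ 1ₚ

-- 6×6 matrices over ℤ_p (indices 0..5 correspond to 1..6 in the paper)

Mat : ℕ → Set
Mat p = Fin 6 → Fin 6 → ℤₚ p

module _ {p : ℕ} where

  sum6 : (Fin 6 → ℤₚ p) → ℤₚ p
  sum6 f = f (# 0) +ₚ (f (# 1) +ₚ (f (# 2) +ₚ (f (# 3) +ₚ (f (# 4) +ₚ f (# 5)))))

  _⊗_ : Mat p → Mat p → Mat p
  (A ⊗ B) i j = sum6 (λ k → A i k *ₚ B k j)

  infixl 7 _⊗_

  transpose : Mat p → Mat p
  transpose A i j = A j i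

  _·M_ : ℤₚ p → Mat p → Mat p
  (c ·M A) i j = c *ₚ A i j

  _≈M_ : Mat p → Mat p → Set
  A ≈M B = ∀ i j → A i j ≈ₚ B i j

  δ : Fin 6 → Fin 6 → ℤₚ p
  δ i j with toℕ i ℕ.≟ toℕ j
  ... | Relation.Nullary.yes _ = 1ₚ
  ... | Relation.Nullary.no _ = 0ₚ

  -- J = [[0, I₃'], [-I₃', 0]]  (I₃' antidiagonal):  J_{ij} = 1 if i+j=5 and i<3,
  -- -1 if i+j=5 and i≥3, 0 otherwise (0-based indices)
  Jmat : Mat p
  Jmat i j with toℕ i ℕ.+ toℕ j ℕ.≟ 5 | toℕ i ℕ.<? 3
  ... | Relation.Nullary.yes _ | Relation.Nullary.yes _ = 1ₚ
  ... | Relation.Nullary.yes _ | Relation.Nullary.no _ = ι (- (+ 1))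
  ... | Relation.Nullary.no _ | _ = 0ₚ

  InG : Mat p → Set
  InG g = ∃ λ ν → IsUnit ν × ((transpose g ⊗ Jmat ⊗ g) ≈M (ν ·M Jmat))

  InKn : ℕ → Mat p → Set
  InKn n g = InG g × (∀ j → g (# 5) j ≡ δ (# 5) j [modp^ n ])

  -- η_p^j = diag(p^{3j}, p^{2j}, p^{2j}, p^j, p^j, 1)
  ηexp : Fin 6 → ℕ
  ηexp i = 3 ℕ.∸ ((toℕ i ℕ.+ 1) ℕ./ 2)

  ηpow : ℕ → Mat p
  ηpow j a b with toℕ a ℕ.≟ toℕ b
  ... | Relation.Nullary.yes _ = ι (+ (p ℕ.^ (ηexp a ℕ.* j)))
  ... | Relation.Nullary.no _ = 0ₚ

  -- g ∈ η^j K_n^p η^{-j}, i.e. g = η^j k η^{-j} for some k ∈ K_n^p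
  -- (equivalently g η^j = η^j k, which stays inside matrices over ℤ_p)
  InEtaConj : ℕ → ℕ → Mat p → Set
  InEtaConj j n g = ∃ λ k → InKn n k × ((g ⊗ ηpow j) ≈M (ηpow j ⊗ k))

  InKG : ℕ → Mat p → Set
  InKG m g = InG g × (∀ i j → g i j ≡ δ i j [modp^ m ])

  K′ : ℕ → ℕ → Mat p → Set
  K′ n m g = InKn n g × InEtaConj m n g × InKG m g

  K′⁽ᵖ⁾ : ℕ → ℕ → Mat p → Set
  K′⁽ᵖ⁾ n m g = InKn n g × InEtaConj (suc m) n g × InKG m g

  -- u_p = [[I₃, T], [0, I₃]],  T = [[1,1,0],[1,0,1],[0,1,1]]  (T_{ab} = 0 iff a+b = 2),
  -- and its inverse [[I₃, -T], [0, I₃]]; s = 1 gives u, s = -1 gives u⁻¹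
  uMatₛ : ℤ → Mat p
  uMatₛ s i j with toℕ i ℕ.≟ toℕ j | toℕ i ℕ.<? 3 | 3 ℕ.≤? toℕ j | toℕ i ℕ.+ toℕ j ℕ.≟ 5
  ... | Relation.Nullary.yes _ | _ | _ | _ = 1ₚ
  ... | Relation.Nullary.no _ | Relation.Nullary.yes _ | Relation.Nullary.yes _ | Relation.Nullary.no _ = ι s
  ... | Relation.Nullary.no _ | _ | _ | _ = 0ₚ

  uMat uInv : Mat p
  uMat = uMatₛ (+ 1)
  uInv = uMatₛ (- (+ 1))

  -- H = GL₂ ×_det GL₂ ×_det GL₂: the i-th factor (a_i b_i; c_i d_i) sits in
  -- rows/columns {i, 5-i} (0-based), zeros elsewhere; the three determinants
  -- agree and are units.
  paired : Fin 6 → Fin 6 → Set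
  paired i j = (toℕ i ≡ toℕ j) Data.Sum.⊎ (toℕ i ℕ.+ toℕ j ≡ 5)
    where import Data.Sum

  blockDet : Mat p → Fin 6 → Fin 6 → ℤₚ p
  blockDet M i i' = (M i i *ₚ M i' i') +ₚ (-ₚ (M i i' *ₚ M i' i))

  InH : Mat p → Set
  InH M = (∀ i j → ¬ paired i j → M i j ≈ₚ 0ₚ)
        × (blockDet M (# 0) (# 5) ≈ₚ blockDet M (# 1) (# 4))
        × (blockDet M (# 1) (# 4) ≈ₚ blockDet M (# 2) (# 3))
        × IsUnit (blockDet M (# 0) (# 5))

{-# OPTIONS --safe #-}
module Submission where

-- Reduce everything modulo P = p^(m+1) and write X for g at that level.  Since
-- g η^(m+1) = η^(m+1) k with k integral, every entry of X strictly above the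
-- η-filtration is divisible by p^(m+1), and since n ≥ m+1 the last row of X is
-- (0,…,0,1).  Writing u = [[I,T],[0,I]], the H-shape of u X u⁻¹ (zero outside the
-- diagonal and antidiagonal) then forces, block by block, every off-diagonal
-- entry of X to vanish mod P.  Once X is diagonal mod P, the off-antidiagonal
-- entries of the upper right block of u X u⁻¹ are the differences
-- X(3+j,3+j) − X(i,i) for T(i,j) = 1, which chain all diagonal entries to X(5,5) ≡ 1
-- (indices 0–5).

open import Defs
open import Data.Fin using (Fin; toℕ)
open import Data.Fin.Patterns
open import Data.Fin.Properties using (toℕ-injective)
open import Data.Integer using (ℤ; +_; -_)
open import Data.Integer.Divisibility.Signed
  using (_∣_; divides; ∣ᵤ⇒∣; ∣⇒∣ᵤ; ∣-trans; ∣m⇒∣-m; ∣m∣n⇒∣m+n; ∣m+n∣m⇒∣n; ∣m+n∣n⇒∣m; ∣m⇒∣m*n; *-cancelˡ-∣)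
import Data.Integer.Properties as ℤP
open import Data.Integer.Tactic.RingSolver using (solve-∀)
import Data.Nat as ℕ
import Data.Nat.Divisibility as ℕ∣
import Data.Nat.Properties as ℕP
open import Data.Product using (_,_)
open import Relation.Binary.PropositionalEquality using (_≡_; _≢_; refl; sym; trans; cong; subst; subst₂)
open import Relation.Nullary using (¬_; yes; no; contradiction)
open import Relation.Nullary.Decidable using (Dec; True; toWitness; ¬?; _⊎-dec_)

module _ where
  open import Data.Integer using (_-_)

  infix 4 _≡_[mod_]

  -- A record rather than a synonym for P ∣ x - y, so that x and y can be inferred.
  record _≡_[mod_] (x y P : ℤ) : Set where
    constructor ≡mod
    field ∣x-y : P ∣ x - y

open _≡_[mod_] public

module _ {P : ℤ} where
  open import Data.Integer using (_+_; _-_)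

  mod-reflexive : ∀ {x y} → x ≡ y → x ≡ y [mod P ]
  mod-reflexive {x} refl = ≡mod (divides (+ 0) (ℤP.+-inverseʳ x))

  mod-refl : ∀ {x} → x ≡ x [mod P ]
  mod-refl = mod-reflexive refl

  mod-sym : ∀ {x y} → x ≡ y [mod P ] → y ≡ x [mod P ]
  mod-sym {x} {y} (≡mod h) = ≡mod (∣ᵤ⇒∣ (subst (ℕ∣._∣_ _) (ℤP.∣i-j∣≡∣j-i∣ x y) (∣⇒∣ᵤ h)))

  mod-trans : ∀ {x y z} → x ≡ y [mod P ] → y ≡ z [mod P ] → x ≡ z [mod P ]
  mod-trans {x} {y} {z} (≡mod h) (≡mod h′) = ≡mod (subst (P ∣_) (ℤP.+-minus-telescope x y z) (∣m∣n⇒∣m+n h h′))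

  mod-weaken : ∀ {Q x y} → P ∣ Q → x ≡ y [mod Q ] → x ≡ y [mod P ]
  mod-weaken P∣Q (≡mod h) = ≡mod (∣-trans P∣Q h)

  private
    interchange-+ : ∀ a b c d → (a - b) + (c - d) ≡ (a + c) - (b + d)
    interchange-+ = solve-∀

    interchange-- : ∀ a b c d → (a - b) - (c - d) ≡ (a - c) - (b - d)
    interchange-- = solve-∀

  mod-+-cong : ∀ {a b c d} → a ≡ b [mod P ] → c ≡ d [mod P ] → a + c ≡ b + d [mod P ]
  mod-+-cong {a} {b} {c} {d} (≡mod h) (≡mod h′) =
    ≡mod (subst (P ∣_) (interchange-+ a b c d) (∣m∣n⇒∣m+n h h′))

  mod---cong : ∀ {a b c d} → a ≡ b [mod P ] → c ≡ d [mod P ] → a - c ≡ b - d [mod P ]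
  mod---cong {a} {b} {c} {d} (≡mod h) (≡mod h′) =
    ≡mod (subst (P ∣_) (interchange-- a b c d) (∣m∣n⇒∣m+n h (∣m⇒∣-m h′)))

  ∣⇒≡0 : ∀ {x} → P ∣ x → x ≡ + 0 [mod P ]
  ∣⇒≡0 {x} h = ≡mod (subst (P ∣_) (sym (ℤP.+-identityʳ x)) h)

  ≡0⇒∣ : ∀ {x} → x ≡ + 0 [mod P ] → P ∣ x
  ≡0⇒∣ {x} (≡mod h) = subst (P ∣_) (ℤP.+-identityʳ x) h

  m-n≡0⇒m≡n : ∀ {m n} → m - n ≡ + 0 [mod P ] → m ≡ n [mod P ]
  m-n≡0⇒m≡n h = ≡mod (≡0⇒∣ h)

  ∣-resp-≡mod : ∀ {m n} → m ≡ n [mod P ] → P ∣ m → P ∣ n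
  ∣-resp-≡mod h ∣m = ≡0⇒∣ (mod-trans (mod-sym h) (∣⇒≡0 ∣m))

  ∣-m⇒∣m : ∀ {m} → P ∣ - m → P ∣ m
  ∣-m⇒∣m {m} h = subst (P ∣_) (ℤP.neg-involutive m) (∣m⇒∣-m h)

  ∣m-n∣n⇒∣m : ∀ {m n} → P ∣ m - n → P ∣ n → P ∣ m
  ∣m-n∣n⇒∣m h ∣n = ∣m+n∣n⇒∣m h (∣m⇒∣-m ∣n)

  ∣m+n+o∣n∣o⇒∣m : ∀ {m n o} → P ∣ m + n + o → P ∣ n → P ∣ o → P ∣ m
  ∣m+n+o∣n∣o⇒∣m h ∣n ∣o = ∣m+n∣n⇒∣m (∣m+n∣n⇒∣m h ∣o) ∣n

  ∣m-n-o∣n∣o⇒∣m : ∀ {m n o} → P ∣ m - n - o → P ∣ n → P ∣ o → P ∣ m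
  ∣m-n-o∣n∣o⇒∣m h ∣n ∣o = ∣m-n∣n⇒∣m (∣m-n∣n⇒∣m h ∣o) ∣n

  ∣m-n-o∣m∣o⇒∣n : ∀ {m n o} → P ∣ m - n - o → P ∣ m → P ∣ o → P ∣ n
  ∣m-n-o∣m∣o⇒∣n h ∣m ∣o = ∣-m⇒∣m (∣m+n∣m⇒∣n (∣m-n∣n⇒∣m h ∣o) ∣m)

  ∣m-n-o∣m∣n⇒∣o : ∀ {m n o} → P ∣ m - n - o → P ∣ m → P ∣ n → P ∣ o
  ∣m-n-o∣m∣n⇒∣o h ∣m ∣n = ∣-m⇒∣m (∣m+n∣m⇒∣n h (∣m∣n⇒∣m+n ∣m (∣m⇒∣-m ∣n)))

Matℤ : Set
Matℤ = Fin 6 → Fin 6 → ℤ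

diagonal : (Fin 6 → ℤ) → Matℤ
diagonal d i j with toℕ i ℕ.≟ toℕ j
... | yes _ = d i
... | no _ = + 0

Iℤ : Matℤ
Iℤ = diagonal (λ _ → + 1)

diagonal-off : ∀ {d i j} → toℕ i ≢ toℕ j → diagonal d i j ≡ + 0
diagonal-off {i = i} {j} i≢j with toℕ i ℕ.≟ toℕ j
... | yes i≡j = contradiction i≡j i≢j
... | no _ = refl

diagonal-cong : ∀ {P d e} → (∀ i → d i ≡ e i [mod P ]) → ∀ i j → diagonal d i j ≡ diagonal e i j [mod P ]
diagonal-cong d≡e i j with toℕ i ℕ.≟ toℕ j
... | yes _ = d≡e i
... | no _ = mod-refl

-- u A and A u⁻¹ for u = [[I₃, T], [0, I₃]]: u adds rows 3–5 to rows 0–2 along T,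
-- and u⁻¹ on the right subtracts columns 0–2 from columns 3–5 along T.
module _ where
  open import Data.Integer using (_+_; _-_)

  u⊗_ : Matℤ → Matℤ
  (u⊗ A) 0F j = A 0F j + A 3F j + A 4F j
  (u⊗ A) 1F j = A 1F j + A 3F j + A 5F j
  (u⊗ A) 2F j = A 2F j + A 4F j + A 5F j
  (u⊗ A) i  j = A i j

  _⊗u⁻¹ : Matℤ → Matℤ
  (A ⊗u⁻¹) i 3F = A i 3F - A i 0F - A i 1F
  (A ⊗u⁻¹) i 4F = A i 4F - A i 0F - A i 2F
  (A ⊗u⁻¹) i 5F = A i 5F - A i 1F - A i 2F
  (A ⊗u⁻¹) i j  = A i j

  u-conj : Matℤ → Matℤ
  u-conj A = (u⊗ A) ⊗u⁻¹

  u⊗-cong : ∀ {P A B} → (∀ i j → A i j ≡ B i j [mod P ]) → ∀ i j → (u⊗ A) i j ≡ (u⊗ B) i j [mod P ]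
  u⊗-cong A≡B 0F j = mod-+-cong (mod-+-cong (A≡B 0F j) (A≡B 3F j)) (A≡B 4F j)
  u⊗-cong A≡B 1F j = mod-+-cong (mod-+-cong (A≡B 1F j) (A≡B 3F j)) (A≡B 5F j)
  u⊗-cong A≡B 2F j = mod-+-cong (mod-+-cong (A≡B 2F j) (A≡B 4F j)) (A≡B 5F j)
  u⊗-cong A≡B 3F j = A≡B 3F j
  u⊗-cong A≡B 4F j = A≡B 4F j
  u⊗-cong A≡B 5F j = A≡B 5F j

  ⊗u⁻¹-cong : ∀ {P A B} → (∀ i j → A i j ≡ B i j [mod P ]) → ∀ i j → (A ⊗u⁻¹) i j ≡ (B ⊗u⁻¹) i j [mod P ]
  ⊗u⁻¹-cong A≡B i 0F = A≡B i 0F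
  ⊗u⁻¹-cong A≡B i 1F = A≡B i 1F
  ⊗u⁻¹-cong A≡B i 2F = A≡B i 2F
  ⊗u⁻¹-cong A≡B i 3F = mod---cong (mod---cong (A≡B i 3F) (A≡B i 0F)) (A≡B i 1F)
  ⊗u⁻¹-cong A≡B i 4F = mod---cong (mod---cong (A≡B i 4F) (A≡B i 0F)) (A≡B i 2F)
  ⊗u⁻¹-cong A≡B i 5F = mod---cong (mod---cong (A≡B i 5F) (A≡B i 1F)) (A≡B i 2F)

  u-conj-cong : ∀ {P A B} → (∀ i j → A i j ≡ B i j [mod P ]) → ∀ i j → u-conj A i j ≡ u-conj B i j [mod P ]
  u-conj-cong A≡B = ⊗u⁻¹-cong (u⊗-cong A≡B)

  module _ (d : Fin 6 → ℤ) where
    u-conj-diagonal₀₃ : u-conj (diagonal d) 0F 3F ≡ d 3F - d 0F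
    u-conj-diagonal₀₃ = gap (d 3F) (d 0F)
      where
      gap : ∀ a b → (+ 0 + a + + 0) - (b + + 0 + + 0) - (+ 0 + + 0 + + 0) ≡ a - b
      gap = solve-∀

    u-conj-diagonal₁₃ : u-conj (diagonal d) 1F 3F ≡ d 3F - d 1F
    u-conj-diagonal₁₃ = gap (d 3F) (d 1F)
      where
      gap : ∀ a b → (+ 0 + a + + 0) - (+ 0 + + 0 + + 0) - (b + + 0 + + 0) ≡ a - b
      gap = solve-∀

    u-conj-diagonal₁₅ : u-conj (diagonal d) 1F 5F ≡ d 5F - d 1F
    u-conj-diagonal₁₅ = gap (d 5F) (d 1F)
      where
      gap : ∀ a b → (+ 0 + + 0 + a) - (b + + 0 + + 0) - (+ 0 + + 0 + + 0) ≡ a - b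
      gap = solve-∀

    u-conj-diagonal₂₄ : u-conj (diagonal d) 2F 4F ≡ d 4F - d 2F
    u-conj-diagonal₂₄ = gap (d 4F) (d 2F)
      where
      gap : ∀ a b → (+ 0 + a + + 0) - (+ 0 + + 0 + + 0) - (b + + 0 + + 0) ≡ a - b
      gap = solve-∀

    u-conj-diagonal₂₅ : u-conj (diagonal d) 2F 5F ≡ d 5F - d 2F
    u-conj-diagonal₂₅ = gap (d 5F) (d 2F)
      where
      gap : ∀ a b → (+ 0 + + 0 + a) - (+ 0 + + 0 + + 0) - (b + + 0 + + 0) ≡ a - b
      gap = solve-∀

on₆ : {B : ℤ → ℤ → ℤ → ℤ → ℤ → ℤ → Set} → (∀ a₀ a₁ a₂ a₃ a₄ a₅ → B a₀ a₁ a₂ a₃ a₄ a₅) →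
      (r : Fin 6 → ℤ) → B (r 0F) (r 1F) (r 2F) (r 3F) (r 4F) (r 5F)
on₆ f r = f (r 0F) (r 1F) (r 2F) (r 3F) (r 4F) (r 5F)

module SixTermSums where
  open import Data.Integer using (_+_; _-_; _*_)

  pickˡ₀ : ∀ a₀ a₁ a₂ a₃ a₄ a₅ q → q * a₀ + (+ 0 * a₁ + (+ 0 * a₂ + (+ 0 * a₃ + (+ 0 * a₄ + + 0 * a₅)))) ≡ q * a₀
  pickˡ₀ = solve-∀
  pickˡ₁ : ∀ a₀ a₁ a₂ a₃ a₄ a₅ q → + 0 * a₀ + (q * a₁ + (+ 0 * a₂ + (+ 0 * a₃ + (+ 0 * a₄ + + 0 * a₅)))) ≡ q * a₁
  pickˡ₁ = solve-∀
  pickˡ₂ : ∀ a₀ a₁ a₂ a₃ a₄ a₅ q → + 0 * a₀ + (+ 0 * a₁ + (q * a₂ + (+ 0 * a₃ + (+ 0 * a₄ + + 0 * a₅)))) ≡ q * a₂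
  pickˡ₂ = solve-∀
  pickˡ₃ : ∀ a₀ a₁ a₂ a₃ a₄ a₅ q → + 0 * a₀ + (+ 0 * a₁ + (+ 0 * a₂ + (q * a₃ + (+ 0 * a₄ + + 0 * a₅)))) ≡ q * a₃
  pickˡ₃ = solve-∀
  pickˡ₄ : ∀ a₀ a₁ a₂ a₃ a₄ a₅ q → + 0 * a₀ + (+ 0 * a₁ + (+ 0 * a₂ + (+ 0 * a₃ + (q * a₄ + + 0 * a₅)))) ≡ q * a₄
  pickˡ₄ = solve-∀
  pickˡ₅ : ∀ a₀ a₁ a₂ a₃ a₄ a₅ q → + 0 * a₀ + (+ 0 * a₁ + (+ 0 * a₂ + (+ 0 * a₃ + (+ 0 * a₄ + q * a₅)))) ≡ q * a₅
  pickˡ₅ = solve-∀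

  pickʳ₀ : ∀ a₀ a₁ a₂ a₃ a₄ a₅ q → a₀ * q + (a₁ * + 0 + (a₂ * + 0 + (a₃ * + 0 + (a₄ * + 0 + a₅ * + 0)))) ≡ a₀ * q
  pickʳ₀ = solve-∀
  pickʳ₁ : ∀ a₀ a₁ a₂ a₃ a₄ a₅ q → a₀ * + 0 + (a₁ * q + (a₂ * + 0 + (a₃ * + 0 + (a₄ * + 0 + a₅ * + 0)))) ≡ a₁ * q
  pickʳ₁ = solve-∀
  pickʳ₂ : ∀ a₀ a₁ a₂ a₃ a₄ a₅ q → a₀ * + 0 + (a₁ * + 0 + (a₂ * q + (a₃ * + 0 + (a₄ * + 0 + a₅ * + 0)))) ≡ a₂ * q
  pickʳ₂ = solve-∀
  pickʳ₃ : ∀ a₀ a₁ a₂ a₃ a₄ a₅ q → a₀ * + 0 + (a₁ * + 0 + (a₂ * + 0 + (a₃ * q + (a₄ * + 0 + a₅ * + 0)))) ≡ a₃ * q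
  pickʳ₃ = solve-∀
  pickʳ₄ : ∀ a₀ a₁ a₂ a₃ a₄ a₅ q → a₀ * + 0 + (a₁ * + 0 + (a₂ * + 0 + (a₃ * + 0 + (a₄ * q + a₅ * + 0)))) ≡ a₄ * q
  pickʳ₄ = solve-∀
  pickʳ₅ : ∀ a₀ a₁ a₂ a₃ a₄ a₅ q → a₀ * + 0 + (a₁ * + 0 + (a₂ * + 0 + (a₃ * + 0 + (a₄ * + 0 + a₅ * q)))) ≡ a₅ * q
  pickʳ₅ = solve-∀

  u-row₀ : ∀ a₀ a₁ a₂ a₃ a₄ a₅ → + 1 * a₀ + (+ 0 * a₁ + (+ 0 * a₂ + (+ 1 * a₃ + (+ 1 * a₄ + + 0 * a₅)))) ≡ a₀ + a₃ + a₄
  u-row₀ = solve-∀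
  u-row₁ : ∀ a₀ a₁ a₂ a₃ a₄ a₅ → + 0 * a₀ + (+ 1 * a₁ + (+ 0 * a₂ + (+ 1 * a₃ + (+ 0 * a₄ + + 1 * a₅)))) ≡ a₁ + a₃ + a₅
  u-row₁ = solve-∀
  u-row₂ : ∀ a₀ a₁ a₂ a₃ a₄ a₅ → + 0 * a₀ + (+ 0 * a₁ + (+ 1 * a₂ + (+ 0 * a₃ + (+ 1 * a₄ + + 1 * a₅)))) ≡ a₂ + a₄ + a₅
  u-row₂ = solve-∀

  u⁻¹-col₃ : ∀ a₀ a₁ a₂ a₃ a₄ a₅ → a₀ * - + 1 + (a₁ * - + 1 + (a₂ * + 0 + (a₃ * + 1 + (a₄ * + 0 + a₅ * + 0)))) ≡ a₃ - a₀ - a₁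
  u⁻¹-col₃ = solve-∀
  u⁻¹-col₄ : ∀ a₀ a₁ a₂ a₃ a₄ a₅ → a₀ * - + 1 + (a₁ * + 0 + (a₂ * - + 1 + (a₃ * + 0 + (a₄ * + 1 + a₅ * + 0)))) ≡ a₄ - a₀ - a₂
  u⁻¹-col₄ = solve-∀
  u⁻¹-col₅ : ∀ a₀ a₁ a₂ a₃ a₄ a₅ → a₀ * + 0 + (a₁ * - + 1 + (a₂ * - + 1 + (a₃ * + 0 + (a₄ * + 0 + a₅ * + 1)))) ≡ a₅ - a₁ - a₂
  u⁻¹-col₅ = solve-∀

open SixTermSums

module _ {p : ℕ.ℕ} where
  open import Data.Integer using (_*_)

  ^-monoʳ-∣ : ∀ {r s} → r ℕ.≤ s → + (p ℕ.^ r) ∣ + (p ℕ.^ s)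
  ^-monoʳ-∣ {r} {s} r≤s = ∣ᵤ⇒∣ (subst (λ e → p ℕ.^ r ℕ∣.∣ p ℕ.^ e) (ℕP.m∸n+n≡m r≤s)
    (subst (p ℕ.^ r ℕ∣.∣_) (sym (ℕP.^-distribˡ-+-* p (s ℕ.∸ r) r)) (ℕ∣.n∣m*n (p ℕ.^ (s ℕ.∸ r)))))

  seq-≡-mod : ∀ (x : ℤₚ p) {r s} → r ℕ.≤ s → seq x s ≡ seq x r [mod + (p ℕ.^ r) ]
  seq-≡-mod x r≤s = go (ℕP.≤⇒≤′ r≤s)
    where
    go : ∀ {r s} → r ℕ.≤′ s → seq x s ≡ seq x r [mod + (p ℕ.^ r) ]
    go ℕ.≤′-refl = mod-refl
    go (ℕ.≤′-step {s} r≤′s) = mod-trans (mod-weaken (^-monoʳ-∣ (ℕP.≤′⇒≤ r≤′s)) (≡mod (coh x s))) (go r≤′s)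

  ≡[modp^]-weaken : ∀ {x y : ℤₚ p} {r s} → r ℕ.≤ s → x ≡ y [modp^ s ] → x ≡ y [modp^ r ]
  ≡[modp^]-weaken {x} {y} r≤s h =
    ∣x-y (mod-trans (mod-sym (seq-≡-mod x r≤s))
      (mod-trans (mod-weaken (^-monoʳ-∣ r≤s) (≡mod h)) (seq-≡-mod y r≤s)))

  ∣-cancel-^ : ∀ {x} e j .{{_ : ℕ.NonZero p}} → + (p ℕ.^ (e ℕ.+ j)) ∣ x * + (p ℕ.^ e) → + (p ℕ.^ j) ∣ x
  ∣-cancel-^ {x} e j h = *-cancelˡ-∣ (+ (p ℕ.^ e)) {{ℕP.m^n≢0 p e}}
    (subst₂ _∣_ (trans (cong +_ (ℕP.^-distribˡ-+-* p e j)) (ℤP.pos-* (p ℕ.^ e) (p ℕ.^ j)))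
      (ℤP.*-comm x _) h)

  _at_ : Mat p → ℕ.ℕ → Matℤ
  (A at k) i j = seq (A i j) k

  δ-at : ∀ k i j → (δ at k) i j ≡ Iℤ i j
  δ-at k i j with toℕ i ℕ.≟ toℕ j
  ... | yes _ = refl
  ... | no _ = refl

  ηℤ : ℕ.ℕ → Fin 6 → ℤ
  ηℤ e a = + (p ℕ.^ (ηexp {p} a ℕ.* e))

  at-⊗-ηpow : ∀ (A : Mat p) e k a b → ((A ⊗ ηpow e) at k) a b ≡ (A at k) a b * ηℤ e b
  at-⊗-ηpow A e k a 0F = on₆ pickʳ₀ ((A at k) a) (ηℤ e 0F)
  at-⊗-ηpow A e k a 1F = on₆ pickʳ₁ ((A at k) a) (ηℤ e 1F)
  at-⊗-ηpow A e k a 2F = on₆ pickʳ₂ ((A at k) a) (ηℤ e 2F)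
  at-⊗-ηpow A e k a 3F = on₆ pickʳ₃ ((A at k) a) (ηℤ e 3F)
  at-⊗-ηpow A e k a 4F = on₆ pickʳ₄ ((A at k) a) (ηℤ e 4F)
  at-⊗-ηpow A e k a 5F = on₆ pickʳ₅ ((A at k) a) (ηℤ e 5F)

  at-ηpow-⊗ : ∀ (A : Mat p) e k a b → ((ηpow e ⊗ A) at k) a b ≡ ηℤ e a * (A at k) a b
  at-ηpow-⊗ A e k 0F b = on₆ pickˡ₀ (λ l → (A at k) l b) (ηℤ e 0F)
  at-ηpow-⊗ A e k 1F b = on₆ pickˡ₁ (λ l → (A at k) l b) (ηℤ e 1F)
  at-ηpow-⊗ A e k 2F b = on₆ pickˡ₂ (λ l → (A at k) l b) (ηℤ e 2F)
  at-ηpow-⊗ A e k 3F b = on₆ pickˡ₃ (λ l → (A at k) l b) (ηℤ e 3F)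
  at-ηpow-⊗ A e k 4F b = on₆ pickˡ₄ (λ l → (A at k) l b) (ηℤ e 4F)
  at-ηpow-⊗ A e k 5F b = on₆ pickˡ₅ (λ l → (A at k) l b) (ηℤ e 5F)

  at-uMat-⊗ : ∀ (A : Mat p) k i j → ((uMat ⊗ A) at k) i j ≡ (u⊗ (A at k)) i j
  at-uMat-⊗ A k 0F j = on₆ u-row₀ (λ l → (A at k) l j)
  at-uMat-⊗ A k 1F j = on₆ u-row₁ (λ l → (A at k) l j)
  at-uMat-⊗ A k 2F j = on₆ u-row₂ (λ l → (A at k) l j)
  at-uMat-⊗ A k 3F j = trans (on₆ pickˡ₃ (λ l → (A at k) l j) (+ 1)) (ℤP.*-identityˡ _)
  at-uMat-⊗ A k 4F j = trans (on₆ pickˡ₄ (λ l → (A at k) l j) (+ 1)) (ℤP.*-identityˡ _)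
  at-uMat-⊗ A k 5F j = trans (on₆ pickˡ₅ (λ l → (A at k) l j) (+ 1)) (ℤP.*-identityˡ _)

  at-⊗-uInv : ∀ (A : Mat p) k i j → ((A ⊗ uInv) at k) i j ≡ ((A at k) ⊗u⁻¹) i j
  at-⊗-uInv A k i 0F = trans (on₆ pickʳ₀ ((A at k) i) (+ 1)) (ℤP.*-identityʳ _)
  at-⊗-uInv A k i 1F = trans (on₆ pickʳ₁ ((A at k) i) (+ 1)) (ℤP.*-identityʳ _)
  at-⊗-uInv A k i 2F = trans (on₆ pickʳ₂ ((A at k) i) (+ 1)) (ℤP.*-identityʳ _)
  at-⊗-uInv A k i 3F = on₆ u⁻¹-col₃ ((A at k) i)
  at-⊗-uInv A k i 4F = on₆ u⁻¹-col₄ ((A at k) i)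
  at-⊗-uInv A k i 5F = on₆ u⁻¹-col₅ ((A at k) i)

  at-u-conj : ∀ {P} (A : Mat p) k i j → ((uMat ⊗ A ⊗ uInv) at k) i j ≡ u-conj (A at k) i j [mod P ]
  at-u-conj A k i j = mod-trans (mod-reflexive (at-⊗-uInv (uMat ⊗ A) k i j))
    (⊗u⁻¹-cong (λ i j → mod-reflexive (at-uMat-⊗ A k i j)) i j)

  -- At level M = e_b·e + e the conjugation reads g_ab p^(e_b·e) ≡ p^(e_a·e) k_ab mod p^M,
  -- and e_a·e ≥ M, so cancelling p^(e_b·e) leaves p^e ∣ g_ab.
  InEtaConj⇒∣ : ∀ {e n g a b} .{{_ : ℕ.NonZero p}} → InEtaConj e n g →
                ηexp {p} b ℕ.< ηexp {p} a → + (p ℕ.^ e) ∣ (g at e) a b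
  InEtaConj⇒∣ {e} {g = g} {a} {b} (k , _ , gη≈ηk) eb<ea =
    ∣-resp-≡mod (seq-≡-mod (g a b) (ℕP.m≤n+m e E)) (∣-cancel-^ E e ∣g·p^E)
    where
    open import Data.Integer using (_-_)
    E = ηexp {p} b ℕ.* e
    M = E ℕ.+ e
    M≤eₐ·e : M ℕ.≤ ηexp {p} a ℕ.* e
    M≤eₐ·e = subst (ℕ._≤ ηexp {p} a ℕ.* e) (ℕP.+-comm e E) (ℕP.*-monoˡ-≤ e eb<ea)
    ∣g·p^E : + (p ℕ.^ M) ∣ (g at M) a b * + (p ℕ.^ E)
    ∣g·p^E = ∣m-n∣n⇒∣m
      (subst₂ (λ x y → + (p ℕ.^ M) ∣ x - y) (at-⊗-ηpow g e M a b) (at-ηpow-⊗ k e M a b) (gη≈ηk a b M))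
      (∣m⇒∣m*n _ (^-monoʳ-∣ M≤eₐ·e))

module _ {p : ℕ.ℕ} {P : ℤ} (X : Matℤ)
  (upper : ∀ {a b} → ηexp {p} b ℕ.< ηexp {p} a → P ∣ X a b)
  (lastRow : ∀ b → X 5F b ≡ Iℤ 5F b [mod P ])
  (H-shaped : ∀ i j → ¬ paired {p} i j → u-conj X i j ≡ + 0 [mod P ])
  where
  private
    paired? : ∀ i j → Dec (paired {p} i j)
    paired? i j = toℕ i ℕ.≟ toℕ j ⊎-dec toℕ i ℕ.+ toℕ j ℕ.≟ 5

    ∣above : ∀ a b {_ : True (ηexp {p} b ℕ.<? ηexp {p} a)} → P ∣ X a b
    ∣above a b {lt} = upper (toWitness lt)

    ∣H : ∀ i j {_ : True (¬? (paired? i j))} → P ∣ u-conj X i j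
    ∣H i j {np} = ≡0⇒∣ (H-shaped i j (toWitness np))

    ∣X₃₂ : P ∣ X 3F 2F
    ∣X₃₂ = ∣m-n-o∣m∣n⇒∣o (∣H 3F 5F) (∣above 3F 5F) (∣H 3F 1F)

    ∣X₄₁ : P ∣ X 4F 1F
    ∣X₄₁ = ∣m-n-o∣m∣o⇒∣n (∣H 4F 5F) (∣above 4F 5F) (∣H 4F 2F)

    ∣X₅ : ∀ b → 5 ≢ toℕ b → P ∣ X 5F b
    ∣X₅ b 5≢b = ≡0⇒∣ (subst (X 5F b ≡_[mod P ]) (diagonal-off {d = λ _ → + 1} 5≢b) (lastRow b))

  offDiagonal : ∀ i j → toℕ i ≢ toℕ j → P ∣ X i j
  offDiagonal 0F 0F i≢i = contradiction refl i≢i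
  offDiagonal 1F 1F i≢i = contradiction refl i≢i
  offDiagonal 2F 2F i≢i = contradiction refl i≢i
  offDiagonal 3F 3F i≢i = contradiction refl i≢i
  offDiagonal 4F 4F i≢i = contradiction refl i≢i
  offDiagonal 5F j  5≢j = ∣X₅ j 5≢j
  offDiagonal 0F 1F _ = ∣above 0F 1F
  offDiagonal 0F 2F _ = ∣above 0F 2F
  offDiagonal 0F 3F _ = ∣above 0F 3F
  offDiagonal 0F 4F _ = ∣above 0F 4F
  offDiagonal 0F 5F _ = ∣above 0F 5F
  offDiagonal 1F 3F _ = ∣above 1F 3F
  offDiagonal 1F 4F _ = ∣above 1F 4F
  offDiagonal 1F 5F _ = ∣above 1F 5F
  offDiagonal 2F 3F _ = ∣above 2F 3F
  offDiagonal 2F 4F _ = ∣above 2F 4F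
  offDiagonal 2F 5F _ = ∣above 2F 5F
  offDiagonal 3F 5F _ = ∣above 3F 5F
  offDiagonal 4F 5F _ = ∣above 4F 5F
  offDiagonal 3F 0F _ = ∣H 3F 0F
  offDiagonal 3F 1F _ = ∣H 3F 1F
  offDiagonal 3F 2F _ = ∣X₃₂
  offDiagonal 3F 4F _ = ∣m-n-o∣n∣o⇒∣m (∣H 3F 4F) (∣H 3F 0F) ∣X₃₂
  offDiagonal 4F 0F _ = ∣H 4F 0F
  offDiagonal 4F 1F _ = ∣X₄₁
  offDiagonal 4F 2F _ = ∣H 4F 2F
  offDiagonal 4F 3F _ = ∣m-n-o∣n∣o⇒∣m (∣H 4F 3F) (∣H 4F 0F) ∣X₄₁
  offDiagonal 1F 0F _ = ∣m+n+o∣n∣o⇒∣m (∣H 1F 0F) (∣H 3F 0F) (∣X₅ 0F λ ())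
  offDiagonal 1F 2F _ = ∣m+n+o∣n∣o⇒∣m (∣H 1F 2F) ∣X₃₂ (∣X₅ 2F λ ())
  offDiagonal 2F 0F _ = ∣m+n+o∣n∣o⇒∣m (∣H 2F 0F) (∣H 4F 0F) (∣X₅ 0F λ ())
  offDiagonal 2F 1F _ = ∣m+n+o∣n∣o⇒∣m (∣H 2F 1F) ∣X₄₁ (∣X₅ 1F λ ())

  diag : Fin 6 → ℤ
  diag k = X k k

  X≡diagonal : ∀ i j → X i j ≡ diagonal diag i j [mod P ]
  X≡diagonal i j with toℕ i ℕ.≟ toℕ j
  ... | yes i≡j rewrite toℕ-injective i≡j = mod-refl
  ... | no i≢j = ∣⇒≡0 (offDiagonal i j i≢j)

  private
    open import Data.Integer using (_-_)

    diagonal-gap : ∀ i j {a b} {np : True (¬? (paired? i j))} →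
                   u-conj (diagonal diag) i j ≡ a - b → a ≡ b [mod P ]
    diagonal-gap i j {np = np} eq = m-n≡0⇒m≡n (subst (_≡ + 0 [mod P ]) eq
      (mod-trans (mod-sym (u-conj-cong X≡diagonal i j)) (H-shaped i j (toWitness np))))

    X₃₃≡X₀₀ : X 3F 3F ≡ X 0F 0F [mod P ]
    X₃₃≡X₀₀ = diagonal-gap 0F 3F (u-conj-diagonal₀₃ diag)

    X₃₃≡X₁₁ : X 3F 3F ≡ X 1F 1F [mod P ]
    X₃₃≡X₁₁ = diagonal-gap 1F 3F (u-conj-diagonal₁₃ diag)

    X₅₅≡X₁₁ : X 5F 5F ≡ X 1F 1F [mod P ]
    X₅₅≡X₁₁ = diagonal-gap 1F 5F (u-conj-diagonal₁₅ diag)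

    X₄₄≡X₂₂ : X 4F 4F ≡ X 2F 2F [mod P ]
    X₄₄≡X₂₂ = diagonal-gap 2F 4F (u-conj-diagonal₂₄ diag)

    X₅₅≡X₂₂ : X 5F 5F ≡ X 2F 2F [mod P ]
    X₅₅≡X₂₂ = diagonal-gap 2F 5F (u-conj-diagonal₂₅ diag)

    X₁₁≡1 : X 1F 1F ≡ + 1 [mod P ]
    X₁₁≡1 = mod-trans (mod-sym X₅₅≡X₁₁) (lastRow 5F)

    X₂₂≡1 : X 2F 2F ≡ + 1 [mod P ]
    X₂₂≡1 = mod-trans (mod-sym X₅₅≡X₂₂) (lastRow 5F)

  diagonal≡1 : ∀ i → X i i ≡ + 1 [mod P ]
  diagonal≡1 0F = mod-trans (mod-sym X₃₃≡X₀₀) (mod-trans X₃₃≡X₁₁ X₁₁≡1)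
  diagonal≡1 1F = X₁₁≡1
  diagonal≡1 2F = X₂₂≡1
  diagonal≡1 3F = mod-trans X₃₃≡X₁₁ X₁₁≡1
  diagonal≡1 4F = mod-trans X₄₄≡X₂₂ X₂₂≡1
  diagonal≡1 5F = lastRow 5F

  u-conj-H-shaped⇒≡I : ∀ i j → X i j ≡ Iℤ i j [mod P ]
  u-conj-H-shaped⇒≡I i j = mod-trans (X≡diagonal i j) (diagonal-cong diagonal≡1 i j)

η-conj∧H-shaped⇒≡δ : ∀ {p n L} .{{_ : ℕ.NonZero p}} (g : Mat p) → L ℕ.≤ n → InKn n g → InEtaConj L n g →
                     (∀ i j → ¬ paired {p} i j → (uMat ⊗ g ⊗ uInv) i j ≈ₚ 0ₚ) →
                     ∀ i j → g i j ≡ δ i j [modp^ L ]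
η-conj∧H-shaped⇒≡δ {p} {n} {L} g L≤n (_ , lastRow) ηconj H-shaped i j =
  ∣x-y (subst (X i j ≡_[mod P ]) (sym (δ-at L i j))
    (u-conj-H-shaped⇒≡I {p = p} X (InEtaConj⇒∣ {e = L} {n = n} {g = g} ηconj) lastRowₗ H-shapedₗ i j))
  where
  P = + (p ℕ.^ L)
  X = g at L

  lastRowₗ : ∀ b → X 5F b ≡ Iℤ 5F b [mod P ]
  lastRowₗ b = subst (X 5F b ≡_[mod P ]) (δ-at L 5F b)
    (≡mod (≡[modp^]-weaken {x = g 5F b} {δ 5F b} L≤n (lastRow b)))

  H-shapedₗ : ∀ i j → ¬ paired {p} i j → u-conj X i j ≡ + 0 [mod P ]
  H-shapedₗ i j np = mod-trans (mod-sym (at-u-conj g L i j)) (≡mod (H-shaped i j np L))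

open import Data.Nat using (ℕ; suc; _≤_; _+_; _*_)
open import Data.Nat.Primality using (Prime; prime⇒nonZero)
open import Function.Bundles using (_⇔_; mk⇔)

lemmaA1 : (p : ℕ) → Prime p → (n m : ℕ) → 1 ≤ n → 1 ≤ m → 3 * m + 3 ≤ n →
    (g : Mat p) → InH (uMat ⊗ g ⊗ uInv) →
    (K′⁽ᵖ⁾ n m g ⇔ K′ n (suc m) g)
lemmaA1 p p-prime n m _ _ 3m+3≤n g (H-shaped , _) = mk⇔ refine coarsen
  where
  instance
    p≢0 : ℕ.NonZero p
    p≢0 = prime⇒nonZero p-prime

  1+m≤3m+3 : suc m ≤ 3 * m + 3
  1+m≤3m+3 = subst (_≤ 3 * m + 3) (ℕP.+-comm m 1) (ℕP.+-mono-≤ (ℕP.m≤n*m m 3) (ℕ.s≤s ℕ.z≤n))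

  1+m≤n : suc m ≤ n
  1+m≤n = ℕP.≤-trans 1+m≤3m+3 3m+3≤n

  refine : K′⁽ᵖ⁾ n m g → K′ n (suc m) g
  refine (g∈Kn , ηconj , g∈G , _) = g∈Kn , ηconj , g∈G , η-conj∧H-shaped⇒≡δ g 1+m≤n g∈Kn ηconj H-shaped

  coarsen : K′ n (suc m) g → K′⁽ᵖ⁾ n m g
  coarsen (g∈Kn , ηconj , g∈G , g≡1) = g∈Kn , ηconj , g∈G , λ i j → ≡[modp^]-weaken {x = g i j} {δ i j} (ℕP.n≤1+n m) (g≡1 i j)
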